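{- Let $k\geq 7$ and $p\geq 2$ be integers with $6p<k$. Then $c^*(C_k^p)=p+1$. Furthermore, if $L\subseteq\{0,\dots,k-1\}$ and $S\subseteq\{0,\dots,k-1\}$ are such that $|S|=p+1$ and $S$ is an inclusion-minimal set with no common neighbor in $L$, then either (a) $S=\{i,i+1,\dots,i+p\}$ for some $i$, or (b) $S=\{i\}\cup\{i+2,i+3,\dots,i+p\}\cup\{i+p+2\}$ for some $i$ (all arithmetic modulo $k$).
   Context: For integers $k\ge3$, $p\ge1$, $C_k^p$ is the graph with vertex set $\{0,1,\dots,k-1\}$ in which distinct $u,v$ are adjacent iff $\min\{|u-v|,k-|u-v|\}\le p$ (no loops). A set $S$ has a common neighbor in $L$ if some vertex of $L$ is adjacent to every vertex of $S$. For a graph $H$, $c^*(H)$ is the maximum over $L\subseteq V(H)$ of the largest size of an inclusion-minimal $S\subseteq V(H)$ without a common neighbor in $L$. -}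

module Defs where

open import Data.Nat using (ℕ; _≤_; _∸_; _+_; ∣_-_∣; _⊓_; _≤ᵇ_)
open import Data.Bool using (if_then_else_)
open import Data.Fin using (Fin; toℕ)
open import Data.Fin.Subset using (Subset; _∈_; _⊂_; ∣_∣)
open import Data.Product using (Σ; _×_; ∃)
open import Relation.Binary.PropositionalEquality using (_≡_; _≢_)
open import Relation.Nullary using (¬_)

Graph : ℕ → Set₁
Graph n = Fin n → Fin n → Set

circDist : (k : ℕ) → Fin k → Fin k → ℕ
circDist k u v = ∣ toℕ u - toℕ v ∣ ⊓ (k ∸ ∣ toℕ u - toℕ v ∣)

Ckp : (k p : ℕ) → Graph k
Ckp k p u v = (u ≢ v) × (circDist k u v ≤ p)

HasCommonNeighbor : ∀ {n} → Graph n → Subset n → Subset n → Set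
HasCommonNeighbor {n} G L S = Σ (Fin n) λ w → (w ∈ L) × (∀ v → v ∈ S → G w v)

MinNoCN : ∀ {n} → Graph n → Subset n → Subset n → Set
MinNoCN G L S = (¬ HasCommonNeighbor G L S)
              × (∀ T → T ⊂ S → HasCommonNeighbor G L T)

CStarEq : ∀ {n} → Graph n → ℕ → Set
CStarEq G m = (Σ _ λ L → Σ _ λ S → MinNoCN G L S × (∣ S ∣ ≡ m))
            × (∀ L S → MinNoCN G L S → ∣ S ∣ ≤ m)

-- offset k i v = (v - i) mod k, as a natural number in [0, k)
offset : (k : ℕ) → Fin k → Fin k → ℕ
offset k i v = if toℕ i ≤ᵇ toℕ v then toℕ v ∸ toℕ i else (k + toℕ v) ∸ toℕ i

-- Let S be inclusion-minimal without a common neighbour in L, with |S| ≥ 3. Each v ∈ S has a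
-- witness in L adjacent to every vertex of S except v; in particular any two vertices of S have a
-- common neighbour (the witness of a third one). Rotating one vertex of S to position 3p therefore
-- puts all of S into [p, 5p], and as 6p < k, adjacency to vertices of S becomes |x - y| ≤ p on ℕ.
-- Let A ≤ B be the extreme positions of S. The witness of an inner vertex v is adjacent to both
-- extremes, hence to every vertex between them unless it is v itself; so inner vertices lie in
-- [B - p, A + p]. If B ≤ A + p, S lies in a block of p + 1 positions, and if B = A + p + 2 in
-- {A} ∪ [A + 2, A + p] ∪ {B}. If B = A + p + 1 the witnesses of the two extremes squeeze the inner
-- vertices into [A + 2, A + p - 1], and if B ≥ A + p + 3 they lie in [A + 3, A + p]; then |S| ≤ p.
-- The bound is attained by {1, …, p + 1} with L the whole vertex set.

module Submission where

open import Defs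
open import Data.Nat using (ℕ; _≤_; _<_; _*_; _+_; suc)
open import Data.Fin using (Fin)
open import Data.Fin.Subset using (Subset; _∈_; ∣_∣)
open import Data.Product using (_×_; Σ)
open import Data.Sum using (_⊎_)
open import Relation.Binary.PropositionalEquality using (_≡_)
open import Function.Bundles using (_⇔_)

open import Data.Nat
open import Data.Nat.Properties
open import Data.Nat.Tactic.RingSolver using (solve; solve-∀)
open import Algebra.Properties.CommutativeSemigroup +-commutativeSemigroup using (xy∙z≈xz∙y)
open import Data.Bool using (true; false; T; if_then_else_)
open import Data.Unit using (tt)
open import Data.Fin using (toℕ; fromℕ<)
import Data.Fin.Properties as Fin
open import Data.Fin.Subset using (_⊂_; ⊤; inside; outside) renaming (⊥ to ∅; _-_ to _-ₛ_)
open import Data.Fin.Subset.Properties using (_∈?_; ∈⊤; ∉⊥; ∣⊥∣≡0; x∈p∧x≢y⇒x∈p-y; x∈p⇒p-x⊂p)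
import Data.Vec.Base as Vec
open import Data.List.Base using (List; []; _∷_; length; applyUpTo; allFin; filter)
open import Data.List.Relation.Unary.Any using (here; there) renaming (any? to anyₗ?)
open import Data.List.Membership.Propositional using () renaming (_∈_ to _∈ₗ_; _∉_ to _∉ₗ_)
open import Data.List.Membership.Propositional.Properties using (∈-applyUpTo⁺; ∈-upTo⁺; ∈-filter⁺; ∈-allFin)
open import Data.List.Properties using (length-applyUpTo)
open import Data.List.Relation.Unary.All using () renaming (lookup to lookupAll)
open import Data.List.Relation.Unary.All.Properties using (all-filter)
open import Data.List.Extrema.Nat using (argmin; argmax; argmin-all; argmax-all; f[argmin]≤f[xs]; f[xs]≤f[argmax])
open import Data.Product using (_,_; proj₁; proj₂; ∃-syntax; uncurry)
import Data.Product as Product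
open import Data.Sum using (inj₁; inj₂)
open import Data.Empty using (⊥-elim)
open import Function using (_∘_; id)
open import Function.Bundles using (mk⇔)
open import Relation.Nullary using (¬_; Dec; yes; no; ¬?)
open import Relation.Nullary.Decidable using (_×-dec_; decidable-stable)
open import Relation.Binary.Definitions using (Tri; tri<; tri≈; tri>)
open import Relation.Binary.PropositionalEquality using (_≢_; refl; sym; trans; cong; cong₂; subst; subst₂; ≢-sym)

InjectiveOn : ∀ {n} {A : Set} → Subset n → (Fin n → A) → Set
InjectiveOn S f = ∀ {u v} → u ∈ S → v ∈ S → f u ≡ f v → u ≡ v

MapsInto : ∀ {n} {A : Set} → Subset n → (Fin n → A) → List A → Set
MapsInto S f xs = ∀ {v} → v ∈ S → f v ∈ₗ xs

remove : ∀ {A : Set} {x : A} {xs} → x ∈ₗ xs →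
  ∃[ ys ] length xs ≡ suc (length ys) × (∀ {y} → y ∈ₗ xs → y ≢ x → y ∈ₗ ys)
remove {xs = _ ∷ xs} (here refl) =
  xs , refl , λ { (here refl) y≢x → ⊥-elim (y≢x refl) ; (there y∈xs) _ → y∈xs }
remove {xs = y ∷ _} (there x∈xs) with ys , eq , keep ← remove x∈xs =
  y ∷ ys , cong suc eq , λ { (here refl) _ → here refl ; (there z∈xs) z≢x → there (keep z∈xs z≢x) }

∣p∣≤length : ∀ {n} {A : Set} (S : Subset n) {f : Fin n → A} {xs} →
  InjectiveOn S f → MapsInto S f xs → ∣ S ∣ ≤ length xs
∣p∣≤length Vec.[]            inj into = z≤n
∣p∣≤length (outside Vec.∷ S) inj into =
  ∣p∣≤length S (λ u∈S v∈S → Fin.suc-injective ∘ inj (Vec.there u∈S) (Vec.there v∈S)) (into ∘ Vec.there)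
∣p∣≤length (inside Vec.∷ S) inj into with ys , eq , keep ← remove (into Vec.here) =
  subst (suc ∣ S ∣ ≤_) (sym eq) (s≤s (∣p∣≤length S
    (λ u∈S v∈S → Fin.suc-injective ∘ inj (Vec.there u∈S) (Vec.there v∈S))
    (λ v∈S → keep (into (Vec.there v∈S)) (λ e → Fin.0≢1+n (inj Vec.here (Vec.there v∈S) (sym e))))))

∈-of-tight-cover : ∀ {n} {A : Set} (S : Subset n) {f : Fin n → A} {xs} →
  (∀ {u v} → f u ≡ f v → u ≡ v) → MapsInto S f xs → length xs ≤ ∣ S ∣ →
  ∀ {v} → f v ∈ₗ xs → v ∈ S
∈-of-tight-cover S inj into tight {v} fv∈xs with v ∈? S
... | yes v∈S = v∈S
... | no v∉S with ys , eq , keep ← remove fv∈xs =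
  ⊥-elim (1+n≰n (≤-trans (subst (_≤ ∣ S ∣) eq tight)
    (∣p∣≤length S (λ _ _ → inj) (λ u∈S → keep (into u∈S) (λ e → v∉S (subst (_∈ S) (inj e) u∈S))))))

∃-∉ : ∀ {n} (S : Subset n) (vs : List (Fin n)) → length vs < ∣ S ∣ → ∃[ v ] v ∈ S × v ∉ₗ vs
∃-∉ S vs len with Fin.any? (λ v → (v ∈? S) ×-dec ¬? (anyₗ? (v Fin.≟_) vs))
... | yes (v , v∈S , v∉vs) = v , v∈S , v∉vs
... | no none = ⊥-elim (<⇒≱ len (∣p∣≤length S (λ _ _ → id)
      (λ {v} v∈S → decidable-stable (anyₗ? (v Fin.≟_) vs) (λ v∉vs → none (v , v∈S , v∉vs)))))

∈-interval : ∀ {a n x} → a ≤ x → x < a + n → x ∈ₗ applyUpTo (a +_) n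
∈-interval {a} {n} {x} a≤x x<a+n = subst (_∈ₗ applyUpTo (a +_) n) (m+[n∸m]≡n a≤x)
  (∈-applyUpTo⁺ (a +_) (subst (x ∸ a <_) (m+n∸m≡n a n) (∸-monoˡ-< x<a+n a≤x)))

IsOffset : ℕ → ℕ → ℕ → ℕ → Set
IsOffset k c x o = o < k × (o + c ≡ x ⊎ o + c ≡ x + k)

<k⇒≢+k : ∀ {m n k} → n < k → n ≢ m + k
<k⇒≢+k {m} {k = k} n<k e = <⇒≱ n<k (subst (k ≤_) (sym e) (m≤n+m k m))

offset-isOffset : ∀ k (i v : Fin k) → IsOffset k (toℕ i) (toℕ v) (offset k i v)
offset-isOffset k i v = go (toℕ i) (toℕ v) (Fin.toℕ<n i) (Fin.toℕ<n v)
  where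
  go : ∀ c x → c < k → x < k → IsOffset k c x (if c ≤ᵇ x then x ∸ c else (k + x) ∸ c)
  go c x c<k x<k with c ≤ᵇ x in eq
  ... | true  = ≤-<-trans (m∸n≤m x c) x<k , inj₁ (m∸n+n≡m (≤ᵇ⇒≤ c x (subst T (sym eq) tt)))
  ... | false = +-cancelʳ-< c _ k (subst (_< k + c) (sym (m∸n+n≡m c≤k+x)) (+-monoʳ-< k x<c))
              , inj₂ (trans (m∸n+n≡m c≤k+x) (+-comm k x))
    where
    x<c : x < c
    x<c = ≰⇒> (λ c≤x → subst T eq (≤⇒≤ᵇ c≤x))
    c≤k+x : c ≤ k + x
    c≤k+x = ≤-trans (<⇒≤ c<k) (m≤m+n k x)

offset<k : ∀ k (i v : Fin k) → offset k i v < k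
offset<k k i v = proj₁ (offset-isOffset k i v)

isOffset-unique : ∀ {k c x o o′} → IsOffset k c x o → IsOffset k c x o′ → o ≡ o′
isOffset-unique (_ , inj₁ e) (_ , inj₁ e′) = +-cancelʳ-≡ _ _ _ (trans e (sym e′))
isOffset-unique (_ , inj₂ e) (_ , inj₂ e′) = +-cancelʳ-≡ _ _ _ (trans e (sym e′))
isOffset-unique {k} {c} {o = o} {o′} (_ , inj₁ e) (o′<k , inj₂ e′) =
  ⊥-elim (<k⇒≢+k o′<k (+-cancelʳ-≡ c o′ (o + k) (trans e′ (trans (cong (_+ k) (sym e)) (xy∙z≈xz∙y o c k)))))
isOffset-unique (o<k , inj₂ e) (o′<k , inj₁ e′) = sym (isOffset-unique (o′<k , inj₁ e′) (o<k , inj₂ e))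

offset-injective : ∀ k (i : Fin k) {u v} → offset k i u ≡ offset k i v → u ≡ v
offset-injective k i {u} {v} eq = Fin.toℕ-injective (same-residue (Fin.toℕ<n u) (Fin.toℕ<n v)
  (proj₂ (offset-isOffset k i u)) (subst (λ o → o + toℕ i ≡ toℕ v ⊎ o + toℕ i ≡ toℕ v + k) (sym eq) (proj₂ (offset-isOffset k i v))))
  where
  same-residue : ∀ {m x y} → x < k → y < k → (m ≡ x ⊎ m ≡ x + k) → (m ≡ y ⊎ m ≡ y + k) → x ≡ y
  same-residue _   _   (inj₁ e) (inj₁ e′) = trans (sym e) e′
  same-residue _   _   (inj₂ e) (inj₂ e′) = +-cancelʳ-≡ _ _ _ (trans (sym e) e′)
  same-residue x<k _   (inj₁ e) (inj₂ e′) = ⊥-elim (<k⇒≢+k x<k (trans (sym e) e′))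
  same-residue _   y<k (inj₂ e) (inj₁ e′) = ⊥-elim (<k⇒≢+k y<k (trans (sym e′) e))

offset-surjective : ∀ k (v : Fin k) {n} → n < k → ∃[ i ] offset k i v ≡ n
offset-surjective k v {n} n<k with n ≤? toℕ v
... | yes n≤v = fromℕ< i<k , isOffset-unique (offset-isOffset k (fromℕ< i<k) v)
      (n<k , inj₁ (trans (cong (n +_) (Fin.toℕ-fromℕ< i<k)) (m+[n∸m]≡n n≤v)))
  where
  i<k : toℕ v ∸ n < k
  i<k = ≤-<-trans (m∸n≤m (toℕ v) n) (Fin.toℕ<n v)
... | no n≰v = fromℕ< i<k , isOffset-unique (offset-isOffset k (fromℕ< i<k) v)
      (n<k , inj₂ (trans (cong (n +_) (Fin.toℕ-fromℕ< i<k)) (m+[n∸m]≡n n≤v+k)))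
  where
  n≤v+k : n ≤ toℕ v + k
  n≤v+k = ≤-trans (<⇒≤ n<k) (m≤n+m k (toℕ v))
  i<k : toℕ v + k ∸ n < k
  i<k = +-cancelʳ-< n _ k (subst (_< k + n) (sym (m∸n+n≡m n≤v+k))
          (subst (_< k + n) (+-comm k (toℕ v)) (+-monoʳ-< k (≰⇒> n≰v))))

offset-rebase : ∀ k (i j v : Fin k) → offset k i j ≤ offset k i v →
  offset k j v + offset k i j ≡ offset k i v
offset-rebase k i j v a≤b =
  trans (cong (_+ a) (isOffset-unique (offset-isOffset k j v) (≤-<-trans (m∸n≤m b a) (offset<k k i v) , shifted)))
        (m∸n+n≡m a≤b)
  where
  a = offset k i j
  b = offset k i v
  d = b ∸ a
  c = toℕ i
  d+[a+c]≡b+c : d + (a + c) ≡ b + c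
  d+[a+c]≡b+c = trans (sym (+-assoc d a c)) (cong (_+ c) (m∸n+n≡m a≤b))
  shifted : d + toℕ j ≡ toℕ v ⊎ d + toℕ j ≡ toℕ v + k
  shifted with proj₂ (offset-isOffset k i j) | proj₂ (offset-isOffset k i v)
  ... | inj₁ a+c≡j | inj₁ b+c≡v = inj₁ (trans (cong (d +_) (sym a+c≡j)) (trans d+[a+c]≡b+c b+c≡v))
  ... | inj₁ a+c≡j | inj₂ b+c≡v+k = inj₂ (trans (cong (d +_) (sym a+c≡j)) (trans d+[a+c]≡b+c b+c≡v+k))
  ... | inj₂ a+c≡j+k | inj₁ b+c≡v =
    ⊥-elim (<k⇒≢+k (Fin.toℕ<n v) (sym (trans (+-assoc d (toℕ j) k) (trans (cong (d +_) (sym a+c≡j+k)) (trans d+[a+c]≡b+c b+c≡v)))))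
  ... | inj₂ a+c≡j+k | inj₂ b+c≡v+k =
    inj₁ (+-cancelʳ-≡ k _ _ (trans (+-assoc d (toℕ j) k) (trans (cong (d +_) (sym a+c≡j+k)) (trans d+[a+c]≡b+c b+c≡v+k))))

wrapMin : ℕ → ℕ → ℕ
wrapMin k d = d ⊓ (k ∸ d)

wrapMin-flip : ∀ {k d} → d ≤ k → wrapMin k (k ∸ d) ≡ wrapMin k d
wrapMin-flip {k} {d} d≤k = trans (cong ((k ∸ d) ⊓_) (m∸[m∸n]≡n d≤k)) (⊓-comm (k ∸ d) d)

∣m-n∣<o : ∀ {m n o} → m < o → n < o → ∣ m - n ∣ < o
∣m-n∣<o {m} {n} m<o n<o with ∣m-n∣≡[m∸n]∨[n∸m] m n
... | inj₁ e = subst (_< _) (sym e) (≤-<-trans (m∸n≤m m n) m<o)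
... | inj₂ e = subst (_< _) (sym e) (≤-<-trans (m∸n≤m n m) n<o)

∣-∣-shift : ∀ a b c {x y} → a + c ≡ x → b + c ≡ y → ∣ x - y ∣ ≡ ∣ a - b ∣
∣-∣-shift a b c refl refl =
  trans (cong₂ ∣_-_∣ (+-comm a c) (+-comm b c)) (∣m+n-m+o∣≡∣n-o∣ c a b)

∣-∣-wrap : ∀ {k a b c x y} → x < k → y < k → b < k → a + c ≡ x → b + c ≡ y + k →
  ∣ x - y ∣ ≡ k ∸ ∣ a - b ∣ × ∣ a - b ∣ ≤ k
∣-∣-wrap {k} {a} {b} {c} {x} {y} x<k y<k b<k a+c≡x b+c≡y+k =
  trans (sym (m+n∸m≡n e D)) (cong (_∸ e) e+D≡k) , subst (e ≤_) e+D≡k (m≤m+n e D)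
  where
  D = ∣ x - y ∣
  D≡∣a+k-b∣ : D ≡ ∣ a + k - b ∣
  D≡∣a+k-b∣ = trans (sym (∣-∣-shift x y k refl refl))
    (∣-∣-shift (a + k) b c (trans (xy∙z≈xz∙y a k c) (cong (_+ k) a+c≡x)) b+c≡y+k)
  b≤a+k : b ≤ a + k
  b≤a+k = ≤-trans (<⇒≤ b<k) (m≤n+m k a)
  b+D≡a+k : b + D ≡ a + k
  b+D≡a+k = trans (cong (b +_) (trans D≡∣a+k-b∣ (m≤n⇒∣n-m∣≡n∸m b≤a+k))) (m+[n∸m]≡n b≤a+k)
  a≤b : a ≤ b
  a≤b = <⇒≤ (+-cancelʳ-< k a b (subst (_< b + k) b+D≡a+k (+-monoʳ-< b (∣m-n∣<o x<k y<k))))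
  e = ∣ a - b ∣
  a+e≡b : a + e ≡ b
  a+e≡b = trans (cong (a +_) (m≤n⇒∣m-n∣≡n∸m a≤b)) (m+[n∸m]≡n a≤b)
  e+D≡k : e + D ≡ k
  e+D≡k = +-cancelˡ-≡ a _ _ (trans (sym (+-assoc a e D)) (trans (cong (_+ D) a+e≡b) b+D≡a+k))

wrapMin-isOffset : ∀ {k c x y a b} → x < k → y < k → IsOffset k c x a → IsOffset k c y b →
  wrapMin k ∣ x - y ∣ ≡ wrapMin k ∣ a - b ∣
wrapMin-isOffset {c = c} {a = a} {b} _ _ (_ , inj₁ e) (_ , inj₁ e′) = cong (wrapMin _) (∣-∣-shift a b c e e′)
wrapMin-isOffset {k} {c} {x} {y} {a} {b} _ _ (_ , inj₂ e) (_ , inj₂ e′) =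
  cong (wrapMin k) (trans (sym (∣-∣-shift x y k refl refl)) (∣-∣-shift a b c e e′))
wrapMin-isOffset x<k y<k (_ , inj₁ e) (b<k , inj₂ e′)
  with D≡k∸d , d≤k ← ∣-∣-wrap x<k y<k b<k e e′ = trans (cong (wrapMin _) D≡k∸d) (wrapMin-flip d≤k)
wrapMin-isOffset {k} {x = x} {y} {a} {b} x<k y<k (a<k , inj₂ e) (b<k , inj₁ e′) =
  trans (cong (wrapMin k) (∣-∣-comm x y))
    (trans (wrapMin-isOffset y<k x<k (b<k , inj₁ e′) (a<k , inj₂ e)) (cong (wrapMin k) (∣-∣-comm b a)))

circDist-offset : ∀ k (i u v : Fin k) → circDist k u v ≡ wrapMin k ∣ offset k i u - offset k i v ∣
circDist-offset k i u v =
  wrapMin-isOffset (Fin.toℕ<n u) (Fin.toℕ<n v) (offset-isOffset k i u) (offset-isOffset k i v)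

Close : ℕ → ℕ → ℕ → Set
Close p a b = a ≤ b + p × b ≤ a + p

CloseMod : ℕ → ℕ → ℕ → ℕ → Set
CloseMod k p a b = Close p a b ⊎ b + k ≤ a + p ⊎ a + k ≤ b + p

closeMod-sym : ∀ {k p a b} → CloseMod k p a b → CloseMod k p b a
closeMod-sym (inj₁ (a≤b+p , b≤a+p)) = inj₁ (b≤a+p , a≤b+p)
closeMod-sym (inj₂ (inj₁ b+k≤a+p))  = inj₂ (inj₂ b+k≤a+p)
closeMod-sym (inj₂ (inj₂ a+k≤b+p))  = inj₂ (inj₁ a+k≤b+p)

∣-∣-split : ∀ a b → a ≡ b + ∣ a - b ∣ ⊎ b ≡ a + ∣ a - b ∣
∣-∣-split a b with ≤-total b a
... | inj₁ b≤a = inj₁ (trans (sym (m+[n∸m]≡n b≤a)) (cong (b +_) (sym (m≤n⇒∣n-m∣≡n∸m b≤a))))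
... | inj₂ a≤b = inj₂ (trans (sym (m+[n∸m]≡n a≤b)) (cong (a +_) (sym (m≤n⇒∣m-n∣≡n∸m a≤b))))

wrapMin≤⇒closeMod : ∀ {k p} a b → wrapMin k ∣ a - b ∣ ≤ p → CloseMod k p a b
wrapMin≤⇒closeMod {k} {p} a b w≤p with ⊓-sel d (k ∸ d) | ∣-∣-split a b
  where d = ∣ a - b ∣
... | inj₁ w≡d | inj₁ a≡b+d = inj₁
  ( subst (_≤ b + p) (sym a≡b+d) (+-monoʳ-≤ b (subst (_≤ p) w≡d w≤p))
  , ≤-trans (subst (b ≤_) (sym a≡b+d) (m≤m+n b _)) (m≤m+n a p) )
... | inj₁ w≡d | inj₂ b≡a+d = inj₁
  ( ≤-trans (subst (a ≤_) (sym b≡a+d) (m≤m+n a _)) (m≤m+n b p)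
  , subst (_≤ a + p) (sym b≡a+d) (+-monoʳ-≤ a (subst (_≤ p) w≡d w≤p)) )
... | inj₂ w≡k∸d | inj₁ a≡b+d = inj₂ (inj₁
  (≤-trans (+-monoʳ-≤ b (k≤d+p w≡k∸d)) (≤-reflexive (trans (sym (+-assoc b _ p)) (cong (_+ p) (sym a≡b+d))))))
  where
  k≤d+p : wrapMin k ∣ a - b ∣ ≡ k ∸ ∣ a - b ∣ → k ≤ ∣ a - b ∣ + p
  k≤d+p e = ≤-trans (m≤n+m∸n k ∣ a - b ∣) (+-monoʳ-≤ ∣ a - b ∣ (subst (_≤ p) e w≤p))
... | inj₂ w≡k∸d | inj₂ b≡a+d = inj₂ (inj₂
  (≤-trans (+-monoʳ-≤ a (k≤d+p w≡k∸d)) (≤-reflexive (trans (sym (+-assoc a _ p)) (cong (_+ p) (sym b≡a+d))))))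
  where
  k≤d+p : wrapMin k ∣ a - b ∣ ≡ k ∸ ∣ a - b ∣ → k ≤ ∣ a - b ∣ + p
  k≤d+p e = ≤-trans (m≤n+m∸n k ∣ a - b ∣) (+-monoʳ-≤ ∣ a - b ∣ (subst (_≤ p) e w≤p))

close⇒wrapMin≤ : ∀ {k p} a b → Close p a b → wrapMin k ∣ a - b ∣ ≤ p
close⇒wrapMin≤ {k} {p} a b (a≤b+p , b≤a+p) = ≤-trans (m⊓n≤m ∣ a - b ∣ _) d≤p
  where
  d≤p : ∣ a - b ∣ ≤ p
  d≤p with ∣-∣-split a b
  ... | inj₁ a≡b+d = +-cancelˡ-≤ b _ _ (subst (_≤ b + p) a≡b+d a≤b+p)
  ... | inj₂ b≡a+d = +-cancelˡ-≤ a _ _ (subst (_≤ a + p) b≡a+d b≤a+p)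

adjacent⇒closeMod : ∀ {k p} (i : Fin k) {u v} → Ckp k p u v → CloseMod k p (offset k i u) (offset k i v)
adjacent⇒closeMod {k} i {u} {v} (_ , d≤p) =
  wrapMin≤⇒closeMod _ _ (subst (_≤ _) (circDist-offset k i u v) d≤p)

close⇒adjacent : ∀ {k p} (i : Fin k) {u v} → u ≢ v → Close p (offset k i u) (offset k i v) → Ckp k p u v
close⇒adjacent {k} i {u} {v} u≢v close =
  u≢v , subst (_≤ _) (sym (circDist-offset k i u v)) (close⇒wrapMin≤ _ _ close)

Unwrapped : ℕ → ℕ → ℕ → Set
Unwrapped k p b = p ≤ b × b + p < k

closeMod⇒close : ∀ {k p a b} → a < k → Unwrapped k p b → CloseMod k p a b → Close p a b
closeMod⇒close _ _ (inj₁ close) = close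
closeMod⇒close {k} {p} {a} {b} a<k (p≤b , _) (inj₂ (inj₁ b+k≤a+p)) =
  ⊥-elim (<-irrefl (+-comm b k) (≤-<-trans b+k≤a+p (+-mono-<-≤ a<k p≤b)))
closeMod⇒close {k} {p} {a} {b} _ (_ , b+p<k) (inj₂ (inj₂ a+k≤b+p)) =
  ⊥-elim (<-irrefl refl (<-≤-trans b+p<k (≤-trans (m≤n+m k a) a+k≤b+p)))

close-interval : ∀ {p a b l u} → Close p a b → l + p ≤ b → b ≤ u → l ≤ a × a ≤ u + p
close-interval {p} {a} {l = l} (a≤b+p , b≤a+p) l+p≤b b≤u =
  +-cancelʳ-≤ p l a (≤-trans l+p≤b b≤a+p) , ≤-trans a≤b+p (+-monoˡ-≤ p b≤u)

module _ {n} (S : Subset n) (f : Fin n → ℕ) {x} (x∈S : x ∈ S) where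

  private
    members : List (Fin n)
    members = filter (_∈? S) (allFin n)

    ∈-members : ∀ {u} → u ∈ S → u ∈ₗ members
    ∈-members u∈S = ∈-filter⁺ (_∈? S) (∈-allFin _) u∈S

  ∃-minimiser : ∃[ lo ] lo ∈ S × (∀ {u} → u ∈ S → f lo ≤ f u)
  ∃-minimiser = argmin f x members , argmin-all f x∈S (all-filter (_∈? S) (allFin n))
              , λ u∈S → lookupAll (f[argmin]≤f[xs] x members) (∈-members u∈S)

  ∃-maximiser : ∃[ hi ] hi ∈ S × (∀ {u} → u ∈ S → f u ≤ f hi)
  ∃-maximiser = argmax f x members , argmax-all f x∈S (all-filter (_∈? S) (allFin n))
              , λ u∈S → lookupAll (f[xs]≤f[argmax] x members) (∈-members u∈S)

minimal⇒witness : ∀ {n} {G : Graph n} {L S : Subset n} → MinNoCN G L S → ∀ {v} → v ∈ S →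
  ∃[ w ] w ∈ L × (∀ {u} → u ∈ S → u ≢ v → G w u) × ¬ G w v
minimal⇒witness {G = G} {S = S} (noCN , minimal) {v} v∈S with minimal (S -ₛ v) (x∈p⇒p-x⊂p v∈S)
... | w , w∈L , adj = w , w∈L , adj′ , λ wv → noCN (w , w∈L , λ u u∈S → adjAll wv u u∈S)
  where
  adj′ : ∀ {u} → u ∈ S → u ≢ v → G w u
  adj′ u∈S u≢v = adj _ (x∈p∧x≢y⇒x∈p-y u∈S u≢v)
  adjAll : G w v → ∀ u → u ∈ S → G w u
  adjAll wv u u∈S with u Fin.≟ v
  ... | yes refl = wv
  ... | no u≢v = adj′ u∈S u≢v

Gapped : ℕ → ℕ → Set
Gapped p o = o ≡ 0 ⊎ (2 ≤ o × o ≤ p) ⊎ o ≡ p + 2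

gappedOffsets : ℕ → List ℕ
gappedOffsets p = 0 ∷ p + 2 ∷ applyUpTo (2 +_) (p ∸ 1)

∈-gappedOffsets : ∀ {p o} → Gapped p o → o ∈ₗ gappedOffsets p
∈-gappedOffsets (inj₁ refl)                                = here refl
∈-gappedOffsets (inj₂ (inj₁ (s≤s (s≤s _) , s≤s o∸2<p∸1))) = there (there (∈-applyUpTo⁺ (2 +_) o∸2<p∸1))
∈-gappedOffsets (inj₂ (inj₂ refl))                         = there (here refl)

length-gappedOffsets : ∀ {p} → 1 ≤ p → length (gappedOffsets p) ≡ suc p
length-gappedOffsets {suc p} _ = cong (2 +_) (length-applyUpTo (2 +_) p)

data Shape (k p : ℕ) (S : Subset k) : Set where
  block  : (i : Fin k) → (∀ {v} → v ∈ S → offset k i v ≤ p) → Shape k p S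
  gapped : (i : Fin k) → (∀ {v} → v ∈ S → Gapped p (offset k i v)) → Shape k p S
  small  : ∣ S ∣ ≤ p → Shape k p S

module _ {k : ℕ} {S : Subset k} (i : Fin k) {P : ℕ → Set} {xs : List ℕ}
         (enumerates : ∀ {o} → P o → o ∈ₗ xs) (offsets-in-P : ∀ {v} → v ∈ S → P (offset k i v)) where

  ∣S∣≤enumeration : ∣ S ∣ ≤ length xs
  ∣S∣≤enumeration = ∣p∣≤length S (λ _ _ → offset-injective k i) (enumerates ∘ offsets-in-P)

  ∈⇔offset-in-P : length xs ≤ ∣ S ∣ → ∀ v → v ∈ S ⇔ P (offset k i v)
  ∈⇔offset-in-P tight v =
    mk⇔ offsets-in-P (∈-of-tight-cover S (offset-injective k i) (enumerates ∘ offsets-in-P) tight ∘ enumerates)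

shape⇒∣S∣≤1+p : ∀ {k p S} → 1 ≤ p → Shape k p S → ∣ S ∣ ≤ suc p
shape⇒∣S∣≤1+p {p = p} {S} _ (block i block-offsets) =
  subst (∣ S ∣ ≤_) (length-applyUpTo id (suc p)) (∣S∣≤enumeration i (∈-upTo⁺ ∘ s≤s) block-offsets)
shape⇒∣S∣≤1+p {S = S} 1≤p (gapped i gapped-offsets) =
  subst (∣ S ∣ ≤_) (length-gappedOffsets 1≤p) (∣S∣≤enumeration i ∈-gappedOffsets gapped-offsets)
shape⇒∣S∣≤1+p _ (small ∣S∣≤p) = m≤n⇒m≤1+n ∣S∣≤p

shape⇒characterisation : ∀ {k p S} → 1 ≤ p → ∣ S ∣ ≡ suc p → Shape k p S →
  (Σ (Fin k) λ i → ∀ v → v ∈ S ⇔ offset k i v ≤ p) ⊎ (Σ (Fin k) λ i → ∀ v → v ∈ S ⇔ Gapped p (offset k i v))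
shape⇒characterisation {p = p} _ ∣S∣≡1+p (block i block-offsets) =
  inj₁ (i , ∈⇔offset-in-P i (∈-upTo⁺ ∘ s≤s) block-offsets
              (≤-reflexive (trans (length-applyUpTo id (suc p)) (sym ∣S∣≡1+p))))
shape⇒characterisation 1≤p ∣S∣≡1+p (gapped i gapped-offsets) =
  inj₂ (i , ∈⇔offset-in-P i ∈-gappedOffsets gapped-offsets
              (≤-reflexive (trans (length-gappedOffsets 1≤p) (sym ∣S∣≡1+p))))
shape⇒characterisation _ ∣S∣≡1+p (small ∣S∣≤p) = ⊥-elim (1+n≰n (subst (_≤ _) ∣S∣≡1+p ∣S∣≤p))

module MinimalSet {k p : ℕ} (6p<k : 6 * p < k) (2≤p : 2 ≤ p) {L S : Subset k}
                  (minimal : MinNoCN (Ckp k p) L S) (3≤∣S∣ : 3 ≤ ∣ S ∣) where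

  private
    3p+p+p+p<k : 3 * p + p + p + p < k
    3p+p+p+p<k = subst (_< k) 6p≡3p+p+p+p 6p<k
      where
      6p≡3p+p+p+p : 6 * p ≡ 3 * p + p + p + p
      6p≡3p+p+p+p = solve (p ∷ [])

    3p+p+p<k : 3 * p + p + p < k
    3p+p+p<k = ≤-<-trans (m≤m+n _ p) 3p+p+p+p<k

    3p+p<k : 3 * p + p < k
    3p+p<k = ≤-<-trans (m≤m+n _ p) 3p+p+p<k

    opaque
      x-spec : ∃[ x ] x ∈ S × x ∉ₗ []
      x-spec = ∃-∉ S [] (≤-trans (s≤s z≤n) 3≤∣S∣)

    x : Fin k
    x = proj₁ x-spec

    x∈S : x ∈ S
    x∈S = proj₁ (proj₂ x-spec)

    opaque
      i-spec : ∃[ i ] offset k i x ≡ 3 * p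
      i-spec = offset-surjective k x (≤-<-trans (m≤m+n _ p) 3p+p<k)

    i : Fin k
    i = proj₁ i-spec

    σ : Fin k → ℕ
    σ = offset k i

  common-neighbour : ∀ {u v} → u ∈ S → v ∈ S → ∃[ w ] Ckp k p w u × Ckp k p w v
  common-neighbour {u} {v} u∈S v∈S = from-third (∃-∉ S (u ∷ v ∷ []) 3≤∣S∣)
    where
    from-third : ∃[ t ] t ∈ S × t ∉ₗ u ∷ v ∷ [] → ∃[ w ] Ckp k p w u × Ckp k p w v
    from-third (t , t∈S , t∉[u,v]) with w , _ , adj , _ ← minimal⇒witness minimal t∈S =
      w , adj u∈S (λ u≡t → t∉[u,v] (here (sym u≡t))) , adj v∈S (λ v≡t → t∉[u,v] (there (here (sym v≡t))))

  window : ∀ {u} → u ∈ S → Unwrapped k p (σ u)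
  window {u} u∈S = through (common-neighbour x∈S u∈S)
    where
    through : ∃[ w ] Ckp k p w x × Ckp k p w u → Unwrapped k p (σ u)
    through (w , w~x , w~u) = proj₁ σu-bounds , ≤-<-trans (+-monoˡ-≤ p (proj₂ σu-bounds)) 3p+p+p+p<k
      where
      w-close-to-3p : Close p (σ w) (3 * p)
      w-close-to-3p = subst (Close p (σ w)) (proj₂ i-spec)
        (closeMod⇒close (offset<k k i w) (subst (Unwrapped k p) (sym (proj₂ i-spec)) (m≤m+n p _ , 3p+p<k))
          (adjacent⇒closeMod i w~x))
      p+p+p≡3p : p + p + p ≡ 3 * p
      p+p+p≡3p = solve (p ∷ [])
      σw-bounds : p + p ≤ σ w × σ w ≤ 3 * p + p
      σw-bounds = close-interval w-close-to-3p (≤-reflexive p+p+p≡3p) ≤-refl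
      u-close-to-w : Close p (σ u) (σ w)
      u-close-to-w = closeMod⇒close (offset<k k i u)
        (≤-trans (m≤m+n p p) (proj₁ σw-bounds) , ≤-<-trans (+-monoˡ-≤ p (proj₂ σw-bounds)) 3p+p+p<k)
        (closeMod-sym (adjacent⇒closeMod i w~u))
      σu-bounds : p ≤ σ u × σ u ≤ 3 * p + p + p
      σu-bounds = close-interval u-close-to-w (proj₁ σw-bounds) (proj₂ σw-bounds)

  adjacent⇒close : ∀ {w u} → u ∈ S → Ckp k p w u → Close p (σ w) (σ u)
  adjacent⇒close {w} u∈S w~u = closeMod⇒close (offset<k k i w) (window u∈S) (adjacent⇒closeMod i w~u)

  private
    opaque
      lo-spec : ∃[ lo ] lo ∈ S × (∀ {u} → u ∈ S → σ lo ≤ σ u)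
      lo-spec = ∃-minimiser S σ x∈S

      hi-spec : ∃[ hi ] hi ∈ S × (∀ {u} → u ∈ S → σ u ≤ σ hi)
      hi-spec = ∃-maximiser S σ x∈S

    lo hi : Fin k
    lo = proj₁ lo-spec
    hi = proj₁ hi-spec

    lo∈S : lo ∈ S
    lo∈S = proj₁ (proj₂ lo-spec)
    hi∈S : hi ∈ S
    hi∈S = proj₁ (proj₂ hi-spec)

    A B : ℕ
    A = σ lo
    B = σ hi

    A≤ : ∀ {u} → u ∈ S → A ≤ σ u
    A≤ = proj₂ (proj₂ lo-spec)
    ≤B : ∀ {u} → u ∈ S → σ u ≤ B
    ≤B = proj₂ (proj₂ hi-spec)

  adjacent-to-ends⇒adjacent : ∀ {w v} → v ∈ S → w ≢ v → Ckp k p w lo → Ckp k p w hi → Ckp k p w v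
  adjacent-to-ends⇒adjacent v∈S w≢v w~lo w~hi = close⇒adjacent i w≢v
    ( ≤-trans (proj₁ (adjacent⇒close lo∈S w~lo)) (+-monoˡ-≤ p (A≤ v∈S))
    , ≤-trans (≤B v∈S) (proj₂ (adjacent⇒close hi∈S w~hi)) )

  interior-bounds : ∀ {v} → v ∈ S → v ≢ lo → v ≢ hi → B ≤ σ v + p × σ v ≤ A + p
  interior-bounds {v} v∈S v≢lo v≢hi with minimal⇒witness minimal v∈S
  ... | w , _ , adj , ¬w~v with w Fin.≟ v
  ...   | yes refl = proj₂ (adjacent⇒close hi∈S (adj hi∈S (≢-sym v≢hi)))
                   , proj₁ (adjacent⇒close lo∈S (adj lo∈S (≢-sym v≢lo)))
  ...   | no w≢v = ⊥-elim (¬w~v (adjacent-to-ends⇒adjacent v∈S w≢v (adj lo∈S (≢-sym v≢lo)) (adj hi∈S (≢-sym v≢hi))))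

  module WideSpan (A+p<B : A + p < B) where

    hi≢lo : hi ≢ lo
    hi≢lo hi≡lo = <⇒≱ A+p<B (≤-trans (≤-reflexive (cong σ hi≡lo)) (m≤m+n A p))

    opaque
      witness-of-lo : ∃[ a ] A + p < σ a × a ≢ hi × (∀ {u} → u ∈ S → u ≢ lo → σ a ≤ σ u + p)
      witness-of-lo with minimal⇒witness minimal lo∈S
      ... | a , _ , adj , ¬a~lo = a , A+p<σa , proj₁ a~hi , λ u∈S u≢lo → proj₁ (adjacent⇒close u∈S (adj u∈S u≢lo))
        where
        a~hi : Ckp k p a hi
        a~hi = adj hi∈S hi≢lo
        a≢lo : a ≢ lo
        a≢lo refl = <⇒≱ A+p<B (proj₂ (adjacent⇒close hi∈S a~hi))
        A+p<σa : A + p < σ a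
        A+p<σa = ≰⇒> λ σa≤A+p → ¬a~lo (close⇒adjacent i a≢lo
          (σa≤A+p , ≤-trans (A≤ hi∈S) (proj₂ (adjacent⇒close hi∈S a~hi))))

      witness-of-hi : ∃[ b ] σ b + p < B × b ≢ lo × (∀ {u} → u ∈ S → u ≢ hi → σ u ≤ σ b + p)
      witness-of-hi with minimal⇒witness minimal hi∈S
      ... | b , _ , adj , ¬b~hi = b , σb+p<B , proj₁ b~lo , λ u∈S u≢hi → proj₂ (adjacent⇒close u∈S (adj u∈S u≢hi))
        where
        b~lo : Ckp k p b lo
        b~lo = adj lo∈S (≢-sym hi≢lo)
        b≢hi : b ≢ hi
        b≢hi refl = <⇒≱ A+p<B (proj₁ (adjacent⇒close lo∈S b~lo))
        σb+p<B : σ b + p < B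
        σb+p<B = ≰⇒> λ B≤σb+p → ¬b~hi (close⇒adjacent i b≢hi
          (≤-trans (proj₁ (adjacent⇒close lo∈S b~lo)) (+-monoˡ-≤ p (A≤ hi∈S)) , B≤σb+p))

  interior⊆interval⇒∣S∣≤2+n : ∀ {a n} → (∀ {u} → u ∈ S → u ≢ lo → u ≢ hi → a ≤ σ u × σ u < a + n) → ∣ S ∣ ≤ 2 + n
  interior⊆interval⇒∣S∣≤2+n {a} {n} interior-inside = subst (∣ S ∣ ≤_) (cong (2 +_) (length-applyUpTo (a +_) n))
    (∣p∣≤length S (λ _ _ → offset-injective k i) cover)
    where
    cover : MapsInto S σ (A ∷ B ∷ applyUpTo (a +_) n)
    cover {u} u∈S with u Fin.≟ lo | u Fin.≟ hi
    ... | yes refl | _        = here refl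
    ... | no _     | yes refl = there (here refl)
    ... | no u≢lo  | no u≢hi  = there (there (uncurry ∈-interval (interior-inside u∈S u≢lo u≢hi)))

  offset-from-lo : ∀ {v} → v ∈ S → offset k lo v + A ≡ σ v
  offset-from-lo {v} v∈S = offset-rebase k i lo v (A≤ v∈S)

  private
    2+[p∸2]≡p : 2 + (p ∸ 2) ≡ p
    2+[p∸2]≡p = m+[n∸m]≡n 2≤p

    A+p≡2+A+[p∸2] : A + p ≡ 2 + A + (p ∸ 2)
    A+p≡2+A+[p∸2] = trans (cong (A +_) (sym 2+[p∸2]≡p)) (trans (+-suc A _) (cong suc (+-suc A _)))

  block-offsets : B ≤ A + p → ∀ {v} → v ∈ S → offset k lo v ≤ p
  block-offsets B≤A+p v∈S = +-cancelʳ-≤ A _ p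
    (subst₂ _≤_ (sym (offset-from-lo v∈S)) (+-comm A p) (≤-trans (≤B v∈S) B≤A+p))

  gapped-offsets : B ≡ 2 + (A + p) → ∀ {v} → v ∈ S → Gapped p (offset k lo v)
  gapped-offsets B≡2+A+p {v} v∈S with v Fin.≟ lo | v Fin.≟ hi
  ... | yes refl | _        = inj₁ (+-cancelʳ-≡ A _ 0 (offset-from-lo v∈S))
  ... | no _     | yes refl = inj₂ (inj₂ (+-cancelʳ-≡ A _ (p + 2)
          (trans (offset-from-lo v∈S) (trans B≡2+A+p (2+[a+b]≡b+2+a A p)))))
    where
    2+[a+b]≡b+2+a : ∀ a b → 2 + (a + b) ≡ b + 2 + a
    2+[a+b]≡b+2+a = solve-∀
  ... | no v≢lo  | no v≢hi  = inj₂ (inj₁ (Product.map 2≤o o≤p (interior-bounds v∈S v≢lo v≢hi)))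
    where
    2≤o : B ≤ σ v + p → 2 ≤ offset k lo v
    2≤o B≤σv+p = +-cancelʳ-≤ (A + p) 2 _
      (subst₂ _≤_ B≡2+A+p (trans (cong (_+ p) (sym (offset-from-lo v∈S))) (+-assoc _ A p)) B≤σv+p)
    o≤p : σ v ≤ A + p → offset k lo v ≤ p
    o≤p σv≤A+p = +-cancelʳ-≤ A _ p (subst₂ _≤_ (sym (offset-from-lo v∈S)) (+-comm A p) σv≤A+p)

  span≡1+p⇒∣S∣≤p : B ≡ suc (A + p) → ∣ S ∣ ≤ p
  span≡1+p⇒∣S∣≤p B≡1+A+p = subst (∣ S ∣ ≤_) 2+[p∸2]≡p (interior⊆interval⇒∣S∣≤2+n between)
    where
    open WideSpan (≤-reflexive (sym B≡1+A+p))
    between : ∀ {u} → u ∈ S → u ≢ lo → u ≢ hi → 2 + A ≤ σ u × σ u < 2 + A + (p ∸ 2)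
    between {u} u∈S u≢lo u≢hi with a , A+p<σa , a≢hi , σa≤ ← witness-of-lo | b , σb+p<B , b≢lo , ≤σb ← witness-of-hi =
      +-cancelʳ-≤ p (2 + A) (σ u) (≤-trans 2+A+p≤σa (σa≤ u∈S u≢lo)) ,
      subst (σ u <_) A+p≡2+A+[p∸2] (≤-<-trans (≤σb u∈S u≢hi) (+-monoˡ-< p σb<A))
      where
      2+A+p≤σa : 2 + (A + p) ≤ σ a
      2+A+p≤σa = ≤∧≢⇒< A+p<σa (λ 1+A+p≡σa → a≢hi (offset-injective k i (trans (sym 1+A+p≡σa) (sym B≡1+A+p))))
      σb<A : σ b < A
      σb<A = ≤∧≢⇒< (+-cancelʳ-≤ p _ A (≤-pred (subst (σ b + p <_) B≡1+A+p σb+p<B)))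
                   (λ σb≡A → b≢lo (offset-injective k i σb≡A))

  span>2+p⇒∣S∣≤p : 2 + (A + p) < B → ∣ S ∣ ≤ p
  span>2+p⇒∣S∣≤p 2+A+p<B = subst (∣ S ∣ ≤_) 2+[p∸2]≡p (interior⊆interval⇒∣S∣≤2+n between)
    where
    between : ∀ {u} → u ∈ S → u ≢ lo → u ≢ hi → 3 + A ≤ σ u × σ u < 3 + A + (p ∸ 2)
    between {u} u∈S u≢lo u≢hi with B≤σu+p , σu≤A+p ← interior-bounds u∈S u≢lo u≢hi =
      +-cancelʳ-≤ p (3 + A) (σ u) (≤-trans 2+A+p<B B≤σu+p) , s≤s (subst (σ u ≤_) A+p≡2+A+[p∸2] σu≤A+p)

  shape : Shape k p S
  shape = by-width (B ≤? A + p) (<-cmp B (2 + (A + p)))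
    where
    by-width : Dec (B ≤ A + p) → Tri (B < 2 + (A + p)) (B ≡ 2 + (A + p)) (2 + (A + p) < B) → Shape k p S
    by-width (yes B≤A+p) _                  = block lo (block-offsets B≤A+p)
    by-width (no B≰A+p)  (tri< B<2+A+p _ _) = small (span≡1+p⇒∣S∣≤p (≤-antisym (≤-pred B<2+A+p) (≰⇒> B≰A+p)))
    by-width (no _)      (tri≈ _ B≡2+A+p _) = gapped lo (gapped-offsets B≡2+A+p)
    by-width (no _)      (tri> _ _ 2+A+p<B) = small (span>2+p⇒∣S∣≤p 2+A+p<B)

below : ℕ → (n : ℕ) → Subset n
below zero    n       = ∅
below (suc m) zero    = Vec.[]
below (suc m) (suc n) = inside Vec.∷ below m n

∈-below⁺ : ∀ {m n} {v : Fin n} → toℕ v < m → v ∈ below m n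
∈-below⁺ {suc m} {v = Fin.zero}  _         = Vec.here
∈-below⁺ {suc m} {v = Fin.suc v} (s≤s v<m) = Vec.there (∈-below⁺ v<m)

∈-below⁻ : ∀ {m n} {v : Fin n} → v ∈ below m n → toℕ v < m
∈-below⁻ {zero}                  v∈∅                 = ⊥-elim (∉⊥ v∈∅)
∈-below⁻ {suc m} {v = Fin.zero}  _                   = s≤s z≤n
∈-below⁻ {suc m} {v = Fin.suc v} (Vec.there v∈below) = s≤s (∈-below⁻ v∈below)

∣below∣ : ∀ {m n} → m ≤ n → ∣ below m n ∣ ≡ m
∣below∣ {zero}  {n}     _         = ∣⊥∣≡0 n
∣below∣ {suc m} {suc n} (s≤s m≤n) = cong suc (∣below∣ m≤n)

module FirstBlock {k p : ℕ} (6p<k : 6 * p < suc k) (1≤p : 1 ≤ p) where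

  S₀ : Subset (suc k)
  S₀ = outside Vec.∷ below (suc p) k

  ∈-S₀⁺ : ∀ {v} → 1 ≤ toℕ v → toℕ v ≤ suc p → v ∈ S₀
  ∈-S₀⁺ {Fin.suc v} _ (s≤s v≤p) = Vec.there (∈-below⁺ (s≤s v≤p))

  ∈-S₀⁻ : ∀ {v} → v ∈ S₀ → 1 ≤ toℕ v × toℕ v ≤ suc p
  ∈-S₀⁻ {Fin.suc v} (Vec.there v∈below) = s≤s z≤n , ∈-below⁻ v∈below

  private
    1+p+p+p<1+k : suc p + p + p < suc k
    1+p+p+p<1+k = ≤-<-trans (subst (suc p + p + p ≤_) p+5p≡6p
      (+-mono-≤ 1≤p (m≤m+n (p + p + p) (p + p)))) 6p<k
      where
      p+5p≡6p : p + (p + p + p + (p + p)) ≡ 6 * p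
      p+5p≡6p = solve (p ∷ [])

    2+p<1+k : 2 + p < suc k
    2+p<1+k = ≤-<-trans (+-monoʳ-≤ 1 (+-monoˡ-≤ p 1≤p)) (≤-<-trans (m≤m+n (suc p + p) p) 1+p+p+p<1+k)

    1<1+k : 1 < suc k
    1<1+k = ≤-<-trans (s≤s z≤n) 2+p<1+k

    1+p<1+k : suc p < suc k
    1+p<1+k = ≤-<-trans (n≤1+n (suc p)) 2+p<1+k

    one top far : Fin (suc k)
    one = fromℕ< 1<1+k
    top = fromℕ< 1+p<1+k
    far = fromℕ< 2+p<1+k

    toℕ-one : toℕ one ≡ 1
    toℕ-one = Fin.toℕ-fromℕ< 1<1+k

    toℕ-top : toℕ top ≡ suc p
    toℕ-top = Fin.toℕ-fromℕ< 1+p<1+k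

    toℕ-far : toℕ far ≡ 2 + p
    toℕ-far = Fin.toℕ-fromℕ< 2+p<1+k

    one∈S₀ : one ∈ S₀
    one∈S₀ = ∈-S₀⁺ (≤-reflexive (sym toℕ-one)) (subst (_≤ suc p) (sym toℕ-one) (s≤s z≤n))

    top∈S₀ : top ∈ S₀
    top∈S₀ = ∈-S₀⁺ (subst (1 ≤_) (sym toℕ-top) (s≤s z≤n)) (≤-reflexive toℕ-top)

    close⇒adjacent₀ : ∀ {u v} → u ≢ v → Close p (toℕ u) (toℕ v) → Ckp (suc k) p u v
    close⇒adjacent₀ = close⇒adjacent Fin.zero

    adjacent⇒closeMod₀ : ∀ {u v} → Ckp (suc k) p u v → CloseMod (suc k) p (toℕ u) (toℕ v)
    adjacent⇒closeMod₀ = adjacent⇒closeMod Fin.zero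

  -- A common neighbour of 1 and p + 1 lies in S₀, so it would have to be adjacent to itself.
  no-common-neighbour : ¬ HasCommonNeighbor (Ckp (suc k) p) ⊤ S₀
  no-common-neighbour (w , _ , adj) = proj₁ (adj w (∈-S₀⁺ (proj₁ w-bounds) w≤1+p)) refl
    where
    w~top : Close p (toℕ w) (suc p)
    w~top = closeMod⇒close (Fin.toℕ<n w) (n≤1+n p , ≤-<-trans (m≤m+n _ p) 1+p+p+p<1+k)
      (subst (CloseMod (suc k) p (toℕ w)) toℕ-top (adjacent⇒closeMod₀ (adj top top∈S₀)))
    w-bounds : 1 ≤ toℕ w × toℕ w ≤ suc p + p
    w-bounds = close-interval w~top ≤-refl ≤-refl
    w≤1+p : toℕ w ≤ suc p
    w≤1+p with toℕ w ≤? suc p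
    ... | yes w≤1+p = w≤1+p
    ... | no w≰1+p = proj₂ (closeMod⇒close 1<1+k
          (≤-trans (n≤1+n p) (<⇒≤ (≰⇒> w≰1+p)) , ≤-<-trans (+-monoˡ-≤ p (proj₂ w-bounds)) 1+p+p+p<1+k)
          (closeMod-sym (subst (CloseMod (suc k) p (toℕ w)) toℕ-one (adjacent⇒closeMod₀ (adj one one∈S₀)))))

  private
    far-adjacent : ∀ {u} → u ∈ S₀ → toℕ u ≢ 1 → Ckp (suc k) p far u
    far-adjacent {u} u∈S₀ u≢1 = close⇒adjacent₀ far≢u (subst (λ f → Close p f (toℕ u)) (sym toℕ-far)
        (+-monoˡ-≤ p 2≤u , ≤-trans u≤1+p (≤-trans (n≤1+n (suc p)) (m≤m+n (2 + p) p))))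
      where
      1≤u = proj₁ (∈-S₀⁻ u∈S₀)
      u≤1+p = proj₂ (∈-S₀⁻ u∈S₀)
      2≤u : 2 ≤ toℕ u
      2≤u = ≤∧≢⇒< 1≤u (≢-sym u≢1)
      far≢u : far ≢ u
      far≢u far≡u = 1+n≰n (subst (_≤ suc p) (trans (sym (cong toℕ far≡u)) toℕ-far) u≤1+p)

    zero-adjacent : ∀ {u} → u ∈ S₀ → toℕ u ≢ suc p → Ckp (suc k) p Fin.zero u
    zero-adjacent {u} u∈S₀ u≢1+p = close⇒adjacent₀ (λ 0≡u → <-irrefl (cong toℕ 0≡u) 1≤u) (z≤n , ≤-pred (≤∧≢⇒< u≤1+p u≢1+p))
      where
      1≤u = proj₁ (∈-S₀⁻ u∈S₀)
      u≤1+p = proj₂ (∈-S₀⁻ u∈S₀)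

    self-adjacent : ∀ {v u} → v ∈ S₀ → toℕ v ≢ suc p → u ∈ S₀ → u ≢ v → Ckp (suc k) p v u
    self-adjacent {v} {u} v∈S₀ v≢1+p u∈S₀ u≢v = close⇒adjacent₀ (≢-sym u≢v)
      ( ≤-trans (≤-pred (≤∧≢⇒< (proj₂ (∈-S₀⁻ v∈S₀)) v≢1+p)) (m≤n+m p (toℕ u))
      , ≤-trans (proj₂ (∈-S₀⁻ u∈S₀)) (+-monoˡ-≤ p (proj₁ (∈-S₀⁻ v∈S₀))) )

  witnesses : ∀ {v} → v ∈ S₀ → ∃[ w ] (∀ {u} → u ∈ S₀ → u ≢ v → Ckp (suc k) p w u)
  witnesses {v} v∈S₀ with toℕ v ≟ 1 | toℕ v ≟ suc p
  ... | yes v≡1 | _ = far , λ u∈S₀ u≢v →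
        far-adjacent u∈S₀ (λ u≡1 → u≢v (Fin.toℕ-injective (trans u≡1 (sym v≡1))))
  ... | no _ | yes v≡1+p = Fin.zero , λ u∈S₀ u≢v →
        zero-adjacent u∈S₀ (λ u≡1+p → u≢v (Fin.toℕ-injective (trans u≡1+p (sym v≡1+p))))
  ... | no _ | no v≢1+p = v , self-adjacent v∈S₀ v≢1+p

  minimal : MinNoCN (Ckp (suc k) p) ⊤ S₀
  minimal = no-common-neighbour , proper-subsets
    where
    proper-subsets : ∀ T → T ⊂ S₀ → HasCommonNeighbor (Ckp (suc k) p) ⊤ T
    proper-subsets T (T⊆S₀ , v , v∈S₀ , v∉T) with w , w~S₀-v ← witnesses v∈S₀ =
      w , ∈⊤ , λ u u∈T → w~S₀-v (T⊆S₀ u∈T) (λ u≡v → v∉T (subst (_∈ T) u≡v u∈T))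

  ∣S₀∣ : ∣ S₀ ∣ ≡ suc p
  ∣S₀∣ = ∣below∣ (≤-pred (≤-<-trans (m≤m+n (suc p) (p + p)) (subst (_< suc k) (+-assoc (suc p) p p) 1+p+p+p<1+k)))

minimal⇒∣S∣≤1+p : ∀ {k p L S} → 6 * p < k → 2 ≤ p → MinNoCN (Ckp k p) L S → ∣ S ∣ ≤ suc p
minimal⇒∣S∣≤1+p {p = p} {S = S} 6p<k 2≤p minimal with 3 ≤? ∣ S ∣
... | yes 3≤∣S∣ = shape⇒∣S∣≤1+p (≤-trans (s≤s z≤n) 2≤p) (MinimalSet.shape 6p<k 2≤p minimal 3≤∣S∣)
... | no 3≰∣S∣ = ≤-trans (≤-pred (≰⇒> 3≰∣S∣)) (m≤n⇒m≤1+n 2≤p)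

minimal⇒characterisation : ∀ {k p L S} → 6 * p < k → 2 ≤ p → MinNoCN (Ckp k p) L S → ∣ S ∣ ≡ suc p →
  (Σ (Fin k) λ i → ∀ v → v ∈ S ⇔ offset k i v ≤ p) ⊎ (Σ (Fin k) λ i → ∀ v → v ∈ S ⇔ Gapped p (offset k i v))
minimal⇒characterisation 6p<k 2≤p minimal ∣S∣≡1+p = shape⇒characterisation (≤-trans (s≤s z≤n) 2≤p) ∣S∣≡1+p
  (MinimalSet.shape 6p<k 2≤p minimal (subst (3 ≤_) (sym ∣S∣≡1+p) (s≤s 2≤p)))

lemma28 : (k p : ℕ) → 7 ≤ k → 2 ≤ p → 6 * p < k →
    CStarEq (Ckp k p) (suc p)
    × (∀ (L S : Subset k) → ∣ S ∣ ≡ suc p → MinNoCN (Ckp k p) L S →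
        (Σ (Fin k) λ i → ∀ v → v ∈ S ⇔ offset k i v ≤ p)
        ⊎ (Σ (Fin k) λ i → ∀ v → v ∈ S ⇔
             (offset k i v ≡ 0 ⊎ (2 ≤ offset k i v × offset k i v ≤ p) ⊎ offset k i v ≡ p + 2)))
lemma28 (suc k) p _ 2≤p 6p<k =
  ( (⊤ , S₀ , minimal , ∣S₀∣) , (λ _ _ → minimal⇒∣S∣≤1+p 6p<k 2≤p) )
  , λ _ _ ∣S∣≡1+p minimal → minimal⇒characterisation 6p<k 2≤p minimal ∣S∣≡1+p
  where
  open FirstBlock 6p<k (≤-trans (s≤s z≤n) 2≤p)
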